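{- Let $G$ be a bipartite graph and let $X$ be a vertex parameter. Then the token sliding $X$-reconfiguration graph $\mathcal{TS}_X(G)$ is bipartite.
   Context: All graphs are finite and simple. A graph parameter $X$ is a vertex parameter if there is a property $x$ of vertex subsets such that either for every graph $G$, $X(G)=\max\{|B|: B\subseteq V(G),\ B \text{ has property } x \text{ in } G\}$, or for every graph $G$, $X(G)=\min\{|B|: B\subseteq V(G),\ B \text{ has property } x \text{ in } G\}$. The token exchange $X$-reconfiguration graph $\mathcal{TE}_X(G)$ has vertex set $\{S\subseteq V(G): |S|=X(G),\ S \text{ has property } x \text{ in } G\}$, with $S_1S_2$ an edge iff there exist $v_1\in S_1\setminus S_2$, $v_2\in S_2\setminus S_1$ with $S_1\setminus\{v_1\}=S_2\setminus\{v_2\}$. The token sliding $X$-reconfiguration graph $\mathcal{TS}_X(G)$ has the same vertex set, with $S_1S_2$ an edge iff such $v_1,v_2$ exist and additionally $v_1v_2\in E(G)$. -}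

module Defs where

open import Data.Nat using (ℕ; _≤_)
open import Data.Bool using (Bool)
open import Data.Fin using (Fin)
open import Data.Fin.Subset using (Subset; _∈_; _∉_; ∣_∣; outside)
open import Data.Vec using (_[_]≔_)
open import Data.Product using (Σ; ∃; _×_; ∃-syntax; _,_)
open import Data.Sum using (_⊎_)
open import Relation.Binary.PropositionalEquality using (_≡_; _≢_)
open import Relation.Nullary using (¬_)

record Graph (n : ℕ) : Set₁ where
  field
    Adj   : Fin n → Fin n → Set
    sym   : ∀ {u v} → Adj u v → Adj v u
    irrefl : ∀ {u} → ¬ Adj u u
open Graph public

IsBipartiteRel : {V : Set} → (V → V → Set) → Set
IsBipartiteRel {V} E = Σ (V → Bool) λ c → ∀ {u v} → E u v → c u ≢ c v

IsBipartite : ∀ {n} → Graph n → Set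
IsBipartite G = IsBipartiteRel (Adj G)

VertexProperty : Set₁
VertexProperty = (n : ℕ) → Graph n → Subset n → Set

GraphParameter : Set₁
GraphParameter = (n : ℕ) → Graph n → ℕ

IsMaxSize : ∀ {n} → (Subset n → Set) → ℕ → Set
IsMaxSize P k = (∃[ B ] (P B × ∣ B ∣ ≡ k)) × (∀ B → P B → ∣ B ∣ ≤ k)

IsMinSize : ∀ {n} → (Subset n → Set) → ℕ → Set
IsMinSize P k = (∃[ B ] (P B × ∣ B ∣ ≡ k)) × (∀ B → P B → k ≤ ∣ B ∣)

IsVertexParameterVia : GraphParameter → VertexProperty → Set₁
IsVertexParameterVia X x =
    (∀ n (G : Graph n) → IsMaxSize (x n G) (X n G))
  ⊎ (∀ n (G : Graph n) → IsMinSize (x n G) (X n G))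

IsVertexParameter : GraphParameter → Set₁
IsVertexParameter X = Σ VertexProperty λ x → IsVertexParameterVia X x

RVertex : GraphParameter → VertexProperty → ∀ n → Graph n → Set
RVertex X x n G = Σ (Subset n) λ S → ∣ S ∣ ≡ X n G × x n G S

TSAdjSet : ∀ {n} → Graph n → Subset n → Subset n → Set
TSAdjSet G S₁ S₂ = Σ (Fin _) λ v₁ → Σ (Fin _) λ v₂ →
    v₁ ∈ S₁ × v₁ ∉ S₂ × v₂ ∈ S₂ × v₂ ∉ S₁
  × (S₁ [ v₁ ]≔ outside) ≡ (S₂ [ v₂ ]≔ outside)
  × Adj G v₁ v₂

TS : (X : GraphParameter) (x : VertexProperty) → ∀ n (G : Graph n) →
     RVertex X x n G → RVertex X x n G → Set
TS X x n G (S₁ , _) (S₂ , _) = TSAdjSet G S₁ S₂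

-- Fix a proper 2-colouring c of G and give each vertex set S the parity of the number of its
-- members of colour true. A slide along the edge v₁v₂ trades a token of colour c v₁ for one of
-- colour c v₂ ≠ c v₁, so it flips this parity: the parity properly 2-colours TS_X(G).
module Submission where

open import Defs hiding (sym)
open import Data.Nat using (ℕ)
open import Data.Bool using (Bool; true; false; _∧_; _xor_)
open import Data.Bool.Properties using (xor-assoc; xor-comm; not-injective)
open import Data.Fin using (Fin; zero; suc)
open import Data.Fin.Subset using (Subset; _∈_; outside)
open import Data.Vec using ([]; _∷_; _[_]≔_; here; there)
open import Data.Product using (_,_; proj₁)
open import Function using (_∘_)
open import Relation.Binary.PropositionalEquality

colourParity : ∀ {n} → (Fin n → Bool) → Subset n → Bool
colourParity c []      = false
colourParity c (b ∷ S) = (b ∧ c zero) xor colourParity (c ∘ suc) S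

colourParity-remove : ∀ {n} (c : Fin n → Bool) {S : Subset n} {v : Fin n} → v ∈ S →
  colourParity c S ≡ colourParity c (S [ v ]≔ outside) xor c v
colourParity-remove c {true ∷ S} here = xor-comm (c zero) (colourParity (c ∘ suc) S)
colourParity-remove c {b ∷ S} {suc v} (there v∈S) = begin
  (b ∧ c zero) xor colourParity (c ∘ suc) S
    ≡⟨ cong ((b ∧ c zero) xor_) (colourParity-remove (c ∘ suc) v∈S) ⟩
  (b ∧ c zero) xor (colourParity (c ∘ suc) (S [ v ]≔ outside) xor c (suc v))
    ≡⟨ xor-assoc (b ∧ c zero) _ _ ⟨
  ((b ∧ c zero) xor colourParity (c ∘ suc) (S [ v ]≔ outside)) xor c (suc v)
    ∎
  where open ≡-Reasoning

xor-cancelˡ : ∀ a {x y} → a xor x ≡ a xor y → x ≡ y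
xor-cancelˡ false eq = eq
xor-cancelˡ true  eq = not-injective eq

TSAdjSet⇒colourParity≢ : ∀ {n} (G : Graph n) {c : Fin n → Bool} →
  (∀ {u v} → Adj G u v → c u ≢ c v) →
  ∀ {S₁ S₂} → TSAdjSet G S₁ S₂ → colourParity c S₁ ≢ colourParity c S₂
TSAdjSet⇒colourParity≢ G {c} proper {S₁} {S₂} (v₁ , v₂ , v₁∈S₁ , _ , v₂∈S₂ , _ , S₁-v₁≡S₂-v₂ , v₁v₂) same =
  proper v₁v₂ (xor-cancelˡ (colourParity c (S₁ [ v₁ ]≔ outside)) (begin
    colourParity c (S₁ [ v₁ ]≔ outside) xor c v₁ ≡⟨ colourParity-remove c v₁∈S₁ ⟨
    colourParity c S₁                            ≡⟨ same ⟩
    colourParity c S₂                            ≡⟨ colourParity-remove c v₂∈S₂ ⟩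
    colourParity c (S₂ [ v₂ ]≔ outside) xor c v₂ ≡⟨ cong (λ R → colourParity c R xor c v₂) S₁-v₁≡S₂-v₂ ⟨
    colourParity c (S₁ [ v₁ ]≔ outside) xor c v₂ ∎))
  where open ≡-Reasoning

mainTheorem1 : (X : GraphParameter) (x : VertexProperty) → IsVertexParameterVia X x →
    (n : ℕ) (G : Graph n) → IsBipartite G → IsBipartiteRel (TS X x n G)
mainTheorem1 X x _ n G (c , proper) =
  (λ S → colourParity c (proj₁ S)) , TSAdjSet⇒colourParity≢ G proper
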